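{- Let $\mathcal{S}=\langle\mathbf{Fm},\vdash\rangle$ be a Hilbert-style logic over a language containing a unary connective $\neg$, and suppose there exist $\alpha\in\mathit{Fm}$ with $\not\vdash\alpha$ and a variable $p\in V$ with $p\notin\mathrm{var}(\alpha)$. Then ECQ fails in the restricted rules companion $\mathcal{S}^{re}=\langle\mathbf{Fm},\vdash^{re}\rangle$ of $\mathcal{S}$.
   Context: $\mathbf{Fm}$ is the formula algebra of a logical language (connectives of finite arity, including unary $\neg$) over a countably infinite set $V$ of variables, universe $\mathit{Fm}$. A Hilbert-style logic is given by schematic (substitution-closed) sets of axioms $A$ and rules $R$ (written $\frac{\Gamma}{\alpha}$); $\Sigma\vdash\varphi$ iff there is a finite sequence ending in $\varphi$ each member of which is an axiom, a member of $\Sigma$, or obtained from earlier members by a rule. $\mathrm{var}(\varphi)$ is the set of variables of $\varphi$, $\mathrm{var}(\Gamma)=\bigcup_{\gamma\in\Gamma}\mathrm{var}(\gamma)$. The restricted rules companion $\mathcal{S}^{re}$ is the Hilbert-style logic with the same axioms and the rules $\{\frac{\Gamma}{\alpha}\in R\mid \mathrm{var}(\Gamma)\subseteq\mathrm{var}(\alpha)\}$. ECQ holds in a logic with consequence $\vdash'$ if $\{\alpha,\neg\alpha\}\vdash'\beta$ for all formulas $\alpha,\beta$; ECQ fails otherwise. -}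

module Defs where

open import Data.Nat using (ℕ)
open import Data.Fin using (Fin)
open import Data.List using (List; [])
open import Data.List.Membership.Propositional using (_∈_)
open import Data.List.Relation.Unary.All using (All)
open import Data.Product using (Σ; ∃; _×_)
open import Data.Sum using (_⊎_)
open import Data.Empty using (⊥)
open import Relation.Nullary using (¬_)
open import Relation.Binary.PropositionalEquality using (_≡_)

record Language : Set₁ where
  field
    Conn      : Set
    arity     : Conn → ℕ
    neg       : Conn
    neg-unary : arity neg ≡ 1

module _ (L : Language) where
  open Language L

  Var : Set
  Var = ℕ

  data Fm : Set where
    var : Var → Fm
    app : (c : Conn) → (Fin (arity c) → Fm) → Fm

  ¬' : Fm → Fm
  ¬' φ = app neg (λ _ → φ)

  data _occursIn_ (p : Var) : Fm → Set where
    here  : p occursIn var p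
    there : ∀ {c f} (i : Fin (arity c)) → p occursIn f i → p occursIn app c f

  _occursInList_ : Var → List Fm → Set
  p occursInList Γ = ∃ λ γ → γ ∈ Γ × p occursIn γ

  subst : (Var → Fm) → Fm → Fm
  subst σ (var p)   = σ p
  subst σ (app c f) = app c (λ i → subst σ (f i))

  substList : (Var → Fm) → List Fm → List Fm
  substList σ []              = []
  substList σ (γ Data.List.∷ Γ) = subst σ γ Data.List.∷ substList σ Γ

  record HilbertLogic : Set₁ where
    field
      Ax          : Fm → Set
      Rule        : List Fm → Fm → Set
      Ax-schem    : ∀ σ φ → Ax φ → Ax (subst σ φ)
      Rule-schem  : ∀ σ Γ α → Rule Γ α → Rule (substList σ Γ) (subst σ α)

  -- Derivations as finite sequences, stored newest-first: the head of the list
  -- is the last member of the sequence; each member is an axiom, a member of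
  -- Σ, or obtained by a rule from earlier members (those further in the list).
  module Derivability (Ax : Fm → Set) (Rule : List Fm → Fm → Set) where
    Justified : (Fm → Set) → List Fm → Fm → Set
    Justified Hyp earlier φ =
      Ax φ ⊎ Hyp φ ⊎ (∃ λ Γ → Rule Γ φ × All (_∈ earlier) Γ)

    data IsDerivation (Hyp : Fm → Set) : List Fm → Set where
      []  : IsDerivation Hyp []
      _∷_ : ∀ {φ earlier} → Justified Hyp earlier φ →
            IsDerivation Hyp earlier → IsDerivation Hyp (φ Data.List.∷ earlier)

    _⊢_ : (Fm → Set) → Fm → Set
    Hyp ⊢ φ = ∃ λ earlier → IsDerivation Hyp (φ Data.List.∷ earlier)

  ∅ : Fm → Set
  ∅ _ = ⊥

  module _ (S : HilbertLogic) where
    open HilbertLogic S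

    RuleRe : List Fm → Fm → Set
    RuleRe Γ α = Rule Γ α × (∀ p → p occursInList Γ → p occursIn α)

    _⊢re_ : (Fm → Set) → Fm → Set
    Hyp ⊢re φ = Derivability._⊢_ Ax RuleRe Hyp φ

    _⊢S_ : (Fm → Set) → Fm → Set
    Hyp ⊢S φ = Derivability._⊢_ Ax Rule Hyp φ

    ECQ-re : Set
    ECQ-re = ∀ α β → (λ φ → φ ≡ α ⊎ φ ≡ ¬' α) ⊢re β

-- A restricted rule never introduces a variable that is absent from its
-- conclusion. Hence, in a restricted derivation from hypotheses that all
-- contain p, every line without p is justified by an axiom or by a rule whose
-- premises are again lines without p; the p-free lines therefore form a
-- derivation in S from no hypotheses. Applied to the instance {p, ¬p} ⊢re α of
-- ECQ, this makes the non-theorem α a theorem of S.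
module Submission where

open import Defs
open import Relation.Nullary using (¬_; Dec; yes; no)
open import Data.Nat using (_≟_)
open import Data.Fin using (cast; zero)
open import Data.Fin.Properties using (any?)
open import Data.List using (List; []; _∷_)
open import Data.List.Membership.Propositional using (_∈_)
open import Data.List.Relation.Unary.Any using (here; there)
open import Data.List.Relation.Unary.All as All using (All)
open import Data.Product using (∃-syntax; _×_; _,_)
open import Data.Sum using (_⊎_; inj₁; inj₂)
open import Data.Empty using (⊥-elim)
open import Relation.Binary.PropositionalEquality using (_≡_; refl; sym)

module _ {L : Language} where
  open Language L

  _occursIn?_ : (p : Var L) (φ : Fm L) → Dec (_occursIn_ L p φ)
  p occursIn? var q with p ≟ q
  ... | yes refl = yes here
  ... | no p≢q   = no λ { here → p≢q refl }
  p occursIn? app c f with any? (λ i → p occursIn? f i)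
  ... | yes (i , p∈fi) = yes (there i p∈fi)
  ... | no  p∉f        = no λ { (there i p∈fi) → p∉f (i , p∈fi) }

  occursIn-¬' : ∀ {p φ} → _occursIn_ L p φ → _occursIn_ L p (¬' L φ)
  occursIn-¬' = there (cast (sym neg-unary) zero)

  module _ {Ax : Fm L → Set} {Rule : List (Fm L) → Fm L → Set} where
    open Derivability L Ax Rule

    ∈-derivable : ∀ {H D ψ} → IsDerivation H D → ψ ∈ D → H ⊢ ψ
    ∈-derivable d@(_ ∷ _)  (here refl) = _ , d
    ∈-derivable (_ ∷ d)    (there ψ∈D) = ∈-derivable d ψ∈D

  module _ (S : HilbertLogic L) (p : Var L) where
    open HilbertLogic S
    module DS = Derivability L Ax Rule
    module DR = Derivability L Ax (RuleRe L S)

    PFreeLinesIn : List (Fm L) → List (Fm L) → Set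
    PFreeLinesIn l D = ∀ {ψ} → ψ ∈ l → ¬ _occursIn_ L p ψ → ψ ∈ D

    PFreeLinesProvable : List (Fm L) → Set
    PFreeLinesProvable l = ∃[ D ] DS.IsDerivation (∅ L) D × PFreeLinesIn l D

    skip-line : ∀ {φ l} → _occursIn_ L p φ →
                PFreeLinesProvable l → PFreeLinesProvable (φ ∷ l)
    skip-line p∈φ (D , d , l⊆D) =
      D , d , λ { (here refl) p∉φ → ⊥-elim (p∉φ p∈φ)
                ; (there ψ∈l) → l⊆D ψ∈l }

    add-line : ∀ {φ l D} → DS.Justified (∅ L) D φ → DS.IsDerivation (∅ L) D →
               PFreeLinesIn l D → PFreeLinesProvable (φ ∷ l)
    add-line j d l⊆D =
      _ , j DS.∷ d , λ { (here refl) _ → here refl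
                       ; (there ψ∈l) p∉ψ → there (l⊆D ψ∈l p∉ψ) }

    pFreeLinesProvable : ∀ {H l} → (∀ {φ} → H φ → _occursIn_ L p φ) →
                         DR.IsDerivation H l → PFreeLinesProvable l
    pFreeLinesProvable H∋p DR.[] = [] , DS.[] , λ ()
    pFreeLinesProvable {l = φ ∷ _} H∋p (j DR.∷ d)
      with pFreeLinesProvable H∋p d
    ... | IH@(D , dD , l⊆D) with j
    ...   | inj₁ ax             = add-line (inj₁ ax) dD l⊆D
    ...   | inj₂ (inj₁ hyp)     = skip-line (H∋p hyp) IH
    ...   | inj₂ (inj₂ (Γ , (rule , Γ⊆φ) , Γ-earlier)) with p occursIn? φ
    ...     | yes p∈φ = skip-line p∈φ IH
    ...     | no  p∉φ = add-line (inj₂ (inj₂ (Γ , rule , Γ-in-D))) dD l⊆D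
      where
        Γ-in-D : All (_∈ D) Γ
        Γ-in-D = All.tabulate λ γ∈Γ →
          l⊆D (All.lookup Γ-earlier γ∈Γ) (λ p∈γ → p∉φ (Γ⊆φ p (_ , γ∈Γ , p∈γ)))

    ⊢re-p-free⇒⊢S : ∀ {H φ} → (∀ {ψ} → H ψ → _occursIn_ L p ψ) →
                    _⊢re_ L S H φ → ¬ _occursIn_ L p φ → _⊢S_ L S (∅ L) φ
    ⊢re-p-free⇒⊢S H∋p (_ , d) p∉φ with pFreeLinesProvable H∋p d
    ... | D , dD , l⊆D = ∈-derivable dD (l⊆D (here refl) p∉φ)

corollary3p11 : (L : Language) (S : HilbertLogic L) (α : Fm L) (p : Var L) →
                ¬ (_⊢S_ L S (∅ L) α) → ¬ (_occursIn_ L p α) → ¬ (ECQ-re L S)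
corollary3p11 L S α p ⊬α p∉α ecq =
  ⊬α (⊢re-p-free⇒⊢S S p p-and-¬p-contain-p (ecq (var p) α) p∉α)
  where
    p-and-¬p-contain-p : ∀ {ψ} → ψ ≡ var p ⊎ ψ ≡ ¬' L (var p) → _occursIn_ L p ψ
    p-and-¬p-contain-p (inj₁ refl) = here
    p-and-¬p-contain-p (inj₂ refl) = occursIn-¬' here
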